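{- Let $(E,\mathcal{P})$ be an abstract network and $\rho, \mu \in [0,1]^E$ with $\sum_{e \in P}\rho_e \ge 1 - \sum_{e \in P}\mu_e$ for all $P \in \mathcal{P}$. Consider the following procedure: initialize $U := \emptyset$; while $\min_{P \in \mathcal{P}} \sum_{f \in P \cap U} (\mu_f + \rho_f) < 1$, choose $P \in \operatorname{argmin}_{P \in \mathcal{P}} \sum_{f \in P \cap U} (\mu_f + \rho_f)$, let $e$ be the $\preceq_P$-minimal element of $P \setminus U$, set $U := U \cup \{e\}$ and $\bar\alpha_e := \min\{\sum_{f \in (P,e)} (\mu_f + \rho_f),\ 1 - \rho_e\}$; finally output $\bar\alpha, U$. Let $\bar\alpha, U$ be the output and define $\bar\rho_e := \rho_e$, $\bar\mu_e := \mu_e$ for $e \in U$ and $\bar\rho_e := 0$, $\bar\mu_e := 0$ for $e \in E \setminus U$. Then (1) $\sum_{e \in P} \bar\rho_e \ge \bar\pi_P := 1 - \sum_{e \in P} \bar\mu_e$ for all $P \in \mathcal{P}$, and (2) $\bar\alpha_e = \min\big(\{\sum_{f \in (Q,e)} (\bar\mu_f + \bar\rho_f) : Q \in \mathcal{P},\ e \in Q\} \cup \{1 - \bar\rho_e\}\big)$ for all $e \in U$.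
   Context: An abstract network is a pair $(E,\mathcal{P})$ with $E$ a finite set and $\mathcal{P} \subseteq 2^E$, where each $P \in \mathcal{P}$ carries a linear order $\preceq_P$ of its elements, such that for all $P, Q \in \mathcal{P}$ and all $e \in P \cap Q$ there exists $R \in \mathcal{P}$ with $R \subseteq \{p \in P : p \preceq_P e\} \cup \{q \in Q : e \preceq_Q q\}$. For $P \in \mathcal{P}$, $e \in P$: $(P,e) := \{p \in P : p \prec_P e\}$. Ties in the argmin of the procedure are broken arbitrarily.
   Formalization: The vectors ρ and μ have entries only in the rational points of $[0,1]$ rather than in all of $[0,1]$. -}

module Defs where

open import Data.Nat using (ℕ)
open import Data.Fin using (Fin; _≟_)
open import Data.Bool using (Bool; true; false)
open import Data.List using (List; []; _∷_; _++_; [_]; filter)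
open import Data.List.Membership.Propositional using (_∈_; _∉_)
open import Data.List.Relation.Unary.Unique.Propositional using (Unique)
open import Data.Fin.Subset using (Subset; ⁅_⁆; _∪_)
  renaming (⊥ to ∅; _∈_ to _∈ₛ_; _∉_ to _∉ₛ_)
open import Data.Fin.Subset.Properties using (_∈?_)
open import Data.Rational using (ℚ; 0ℚ; 1ℚ; _+_; _-_; _≤_; _<_; _⊓_)
open import Data.Product using (Σ; ∃; ∃-syntax; _×_; _,_)
open import Data.Sum using (_⊎_)
open import Relation.Nullary using (yes; no)
open import Relation.Binary.PropositionalEquality using (_≡_)
open import Relation.Binary.Construct.Closure.ReflexiveTransitive using (Star)
open import Function.Bundles using (_⇔_)

sumL : {n : ℕ} → (Fin n → ℚ) → List (Fin n) → ℚ
sumL w []       = 0ℚ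
sumL w (x ∷ xs) = w x + sumL w xs

-- For a path P (a duplicate-free list, ordered by ≼_P = list order) and e,
-- (P,e) = elements strictly before (the first occurrence of) e
before : {n : ℕ} → List (Fin n) → Fin n → List (Fin n)
before []       e = []
before (x ∷ xs) e with x ≟ e
... | yes _ = []
... | no  _ = x ∷ before xs e

from : {n : ℕ} → List (Fin n) → Fin n → List (Fin n)
from []       e = []
from (x ∷ xs) e with x ≟ e
... | yes _ = x ∷ xs
... | no  _ = from xs e

-- An abstract network on the ground set E = Fin n.
-- 𝒫 = { path i : i : Fin m }, each path a duplicate-free list (its order is ≼_P);
-- distinct indices give distinct subsets of E (𝒫 is a set of subsets).
record Network (n : ℕ) : Set where
  field
    m       : ℕ
    path    : Fin m → List (Fin n)
    unique  : ∀ i → Unique (path i)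
    distinct : ∀ i j → (∀ x → (x ∈ path i) ⇔ (x ∈ path j)) → i ≡ j
    axiom   : ∀ i j e → e ∈ path i → e ∈ path j →
              ∃[ k ] (∀ x → x ∈ path k →
                (x ∈ (before (path i) e ++ [ e ])) ⊎ (x ∈ from (path j) e))

restrict : {n : ℕ} → Subset n → (Fin n → ℚ) → Fin n → ℚ
restrict U w x with x ∈? U
... | yes _ = w x
... | no  _ = 0ℚ

update : {n : ℕ} → (Fin n → ℚ) → Fin n → ℚ → Fin n → ℚ
update α e a x with x ≟ e
... | yes _ = a
... | no  _ = α x

IsMinOf : ℚ → (ℚ → Set) → Set
IsMinOf a S = S a × (∀ b → S b → a ≤ b)

module Procedure {n : ℕ} (N : Network n) (ρ μ : Fin n → ℚ) where
  open Network N

  μρ : Fin n → ℚ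
  μρ f = μ f + ρ f

  load : Subset n → List (Fin n) → ℚ
  load U P = sumL μρ (filter (_∈? U) P)

  State : Set
  State = Subset n × (Fin n → ℚ)

  initial : State
  initial = (∅ , λ _ → 0ℚ)

  -- one iteration of the while loop (any argmin P may be chosen)
  data Step : State → State → Set where
    step : ∀ {U α} (i : Fin m) (e : Fin n) →
           load U (path i) < 1ℚ →
           (∀ j → load U (path i) ≤ load U (path j)) →
           e ∈ path i → e ∉ₛ U →
           (∀ x → x ∈ before (path i) e → x ∈ₛ U) →
           Step (U , α)
                (U ∪ ⁅ e ⁆ , update α e (sumL μρ (before (path i) e) ⊓ (1ℚ - ρ e)))

  Terminal : State → Set
  Terminal (U , α) = ∀ j → 1ℚ ≤ load U (path j)

  Output : Subset n → (Fin n → ℚ) → Set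
  Output U α = Star Step initial (U , α) × Terminal (U , α)

{-# OPTIONS --safe #-}
module Submission where

-- Each e is added to U through an argmin path P with (P,e) ⊆ U and e ∉ U.  For any other
-- path Q through e, the network axiom yields a path inside (Q,e) ∪ {e} ∪ [e,P); as e does not
-- count towards the current load, minimality of P gives Σ_(P,e) (μ+ρ) ≤ Σ_(Q,e)∩U (μ+ρ).
-- Enlarging U preserves this, and at the end (P,e) ⊆ U makes the left side a candidate in (2).
-- Part (1) is the stopping condition of the loop.

open import Defs
open import Data.Nat using (ℕ)
open import Data.Fin using (Fin; _≟_)
open import Data.Fin.Subset using (Subset; _∪_; ⁅_⁆)
  renaming (_∈_ to _∈ₛ_; _∉_ to _∉ₛ_; _⊆_ to _⊆ₛ_)
open import Data.Fin.Subset.Properties using (_∈?_; ∉⊥; x∈p∪q⁻; p⊆p∪q; x∈⁅y⁆⇒x≡y)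
open import Data.List using (List; []; _∷_; _++_; [_]; filter)
open import Data.List.Properties using (filter-all)
open import Data.List.Membership.Propositional using (_∈_)
open import Data.List.Membership.Propositional.Properties using (∈-++⁺ˡ; ∈-++⁺ʳ; ∈-filter⁻)
open import Data.List.Relation.Binary.Subset.Propositional using (_⊆_)
open import Data.List.Relation.Unary.Any using (here; there)
open import Data.List.Relation.Unary.AllPairs using ([]; _∷_)
open import Data.List.Relation.Unary.Unique.Propositional using (Unique)
open import Data.List.Relation.Unary.Unique.Propositional.Properties using (filter⁺)
open import Data.Rational using (ℚ; 0ℚ; 1ℚ; _+_; -_; _-_; _≤_; _⊓_)
open import Data.Rational.Properties
  using (≤-refl; ≤-reflexive; ≤-trans; +-mono-≤; +-monoˡ-≤; +-monoʳ-≤; +-identityˡ; +-identityʳ;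
         +-assoc; ⊓-sel; p⊓q≤p; p⊓q≤q; +-0-group; +-0-abelianGroup; +-0-commutativeMonoid;
         module ≤-Reasoning)
open import Algebra.Bundles using (CommutativeMonoid)
open import Algebra.Properties.Group +-0-group using (//-rightDividesʳ)
open import Algebra.Properties.AbelianGroup +-0-abelianGroup using (xyx⁻¹≈y)
open import Algebra.Properties.CommutativeSemigroup
  (CommutativeMonoid.commutativeSemigroup +-0-commutativeMonoid) using (interchange; x∙yz≈y∙xz)
open import Data.Product using (∃-syntax; _×_; _,_; proj₁)
open import Data.Sum using (_⊎_; inj₁; inj₂)
open import Data.Empty using (⊥-elim)
open import Function using (_∘_)
open import Relation.Nullary using (yes; no; ¬?)
open import Relation.Binary.PropositionalEquality
  using (_≡_; _≢_; refl; sym; trans; cong; cong₂; subst; subst₂; module ≡-Reasoning)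
open import Relation.Binary.Construct.Closure.ReflexiveTransitive using (Star; ε; _◅_)

private
  variable
    n : ℕ
    w v : Fin n → ℚ
    xs ys : List (Fin n)

+-cancelʳ-≤ : ∀ {p q} r → p + r ≤ q + r → p ≤ q
+-cancelʳ-≤ {p} {q} r p+r≤q+r =
  subst₂ _≤_ (//-rightDividesʳ r p) (//-rightDividesʳ r q) (+-monoˡ-≤ (- r) p+r≤q+r)

p≤q+r⇒p-q≤r : ∀ {p q r} → p ≤ q + r → p - q ≤ r
p≤q+r⇒p-q≤r {p} {q} {r} p≤q+r = subst (p - q ≤_) (xyx⁻¹≈y q r) (+-monoˡ-≤ (- q) p≤q+r)

⊓-isMinOf : ∀ {a b} {S : ℚ → Set} → S a → S b → (∀ c → S c → a ≤ c ⊎ b ≤ c) → IsMinOf (a ⊓ b) S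
⊓-isMinOf {a} {b} {S} Sa Sb lower = member (⊓-sel a b) , bound
  where
  member : a ⊓ b ≡ a ⊎ a ⊓ b ≡ b → S (a ⊓ b)
  member (inj₁ eq) = subst S (sym eq) Sa
  member (inj₂ eq) = subst S (sym eq) Sb
  bound : ∀ c → S c → a ⊓ b ≤ c
  bound c Sc with lower c Sc
  ... | inj₁ a≤c = ≤-trans (p⊓q≤p a b) a≤c
  ... | inj₂ b≤c = ≤-trans (p⊓q≤q a b) b≤c

sumL-cong : (∀ x → w x ≡ v x) → ∀ xs → sumL w xs ≡ sumL v xs
sumL-cong w≡v []       = refl
sumL-cong w≡v (x ∷ xs) = cong₂ _+_ (w≡v x) (sumL-cong w≡v xs)

sumL-mono : (∀ x → w x ≤ v x) → ∀ xs → sumL w xs ≤ sumL v xs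
sumL-mono w≤v []       = ≤-refl
sumL-mono w≤v (x ∷ xs) = +-mono-≤ (w≤v x) (sumL-mono w≤v xs)

sumL-++ : ∀ (w : Fin n → ℚ) xs ys → sumL w (xs ++ ys) ≡ sumL w xs + sumL w ys
sumL-++ w []       ys = sym (+-identityˡ _)
sumL-++ w (x ∷ xs) ys = trans (cong (w x +_) (sumL-++ w xs ys)) (sym (+-assoc (w x) _ _))

sumL-+ : ∀ (w v : Fin n → ℚ) xs → sumL (λ x → w x + v x) xs ≡ sumL w xs + sumL v xs
sumL-+ w v []       = sym (+-identityˡ 0ℚ)
sumL-+ w v (x ∷ xs) = trans (cong (w x + v x +_) (sumL-+ w v xs)) (interchange (w x) (v x) _ _)

removeAll : Fin n → List (Fin n) → List (Fin n)
removeAll a = filter (λ x → ¬? (a ≟ x))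

sumL-≤-+-removeAll : (∀ x → 0ℚ ≤ w x) → ∀ a → Unique xs →
                     sumL w xs ≤ w a + sumL w (removeAll a xs)
sumL-≤-+-removeAll {w = w} w≥0 a [] = subst (_≤ w a + 0ℚ) (+-identityʳ 0ℚ) (+-monoˡ-≤ 0ℚ (w≥0 a))
sumL-≤-+-removeAll {w = w} {xs = x ∷ xs} w≥0 a (x∉xs ∷ uxs) with a ≟ x
... | yes refl = ≤-reflexive (cong (λ ys → w x + sumL w ys) (sym (filter-all (λ y → ¬? (x ≟ y)) x∉xs)))
... | no _     = subst (w x + sumL w xs ≤_) (x∙yz≈y∙xz (w x) (w a) _)
                   (+-monoʳ-≤ (w x) (sumL-≤-+-removeAll w≥0 a uxs))

sumL-mono-⊆ : (∀ x → 0ℚ ≤ w x) → Unique xs → xs ⊆ ys → sumL w xs ≤ sumL w ys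
sumL-mono-⊆ {xs = []}    {ys = []} w≥0 _ _ = ≤-refl
sumL-mono-⊆ {xs = x ∷ _} {ys = []} w≥0 _ xs⊆[] with xs⊆[] (here refl)
... | ()
sumL-mono-⊆ {w = w} {xs = xs} {ys = y ∷ ys} w≥0 uxs xs⊆y∷ys =
  ≤-trans (sumL-≤-+-removeAll w≥0 y uxs)
          (+-monoʳ-≤ (w y) (sumL-mono-⊆ w≥0 (filter⁺ (λ x → ¬? (y ≟ x)) uxs) removed⊆ys))
  where
  removed⊆ys : removeAll y xs ⊆ ys
  removed⊆ys x∈ with ∈-filter⁻ (λ x → ¬? (y ≟ x)) x∈
  ... | x∈xs , y≢x with xs⊆y∷ys x∈xs
  ...   | here x≡y   = ⊥-elim (y≢x (sym x≡y))
  ...   | there x∈ys = x∈ys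

before-++-from : ∀ (xs : List (Fin n)) e → before xs e ++ from xs e ≡ xs
before-++-from []       e = refl
before-++-from (x ∷ xs) e with x ≟ e
... | yes _ = refl
... | no _  = cong (x ∷_) (before-++-from xs e)

restrict-∈ : ∀ {U : Subset n} {x} w → x ∈ₛ U → restrict U w x ≡ w x
restrict-∈ {U = U} {x} w x∈U with x ∈? U
... | yes _   = refl
... | no x∉U  = ⊥-elim (x∉U x∈U)

restrict-∉ : ∀ {U : Subset n} {x} w → x ∉ₛ U → restrict U w x ≡ 0ℚ
restrict-∉ {U = U} {x} w x∉U with x ∈? U
... | yes x∈U = ⊥-elim (x∉U x∈U)
... | no _    = refl

restrict-+ : ∀ (U : Subset n) w v x → restrict U (λ y → w y + v y) x ≡ restrict U w x + restrict U v x
restrict-+ U w v x with x ∈? U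
... | yes _ = refl
... | no _  = sym (+-identityˡ 0ℚ)

restrict-nonneg : ∀ (U : Subset n) → (∀ x → 0ℚ ≤ w x) → ∀ x → 0ℚ ≤ restrict U w x
restrict-nonneg U w≥0 x with x ∈? U
... | yes _ = w≥0 x
... | no _  = ≤-refl

restrict-mono : ∀ {U V : Subset n} → (∀ x → 0ℚ ≤ w x) → U ⊆ₛ V → ∀ x → restrict U w x ≤ restrict V w x
restrict-mono {U = U} {V} w≥0 U⊆V x with x ∈? U | x ∈? V
... | yes _   | yes _   = ≤-refl
... | yes x∈U | no x∉V  = ⊥-elim (x∉V (U⊆V x∈U))
... | no _    | yes _   = w≥0 x
... | no _    | no _    = ≤-refl

sumL-restrict : ∀ (U : Subset n) w xs → (∀ x → x ∈ xs → x ∈ₛ U) → sumL (restrict U w) xs ≡ sumL w xs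
sumL-restrict U w []       _     = refl
sumL-restrict U w (x ∷ xs) xs⊆U =
  cong₂ _+_ (restrict-∈ w (xs⊆U x (here refl))) (sumL-restrict U w xs (λ y y∈ → xs⊆U y (there y∈)))

sumL-filter-∈ : ∀ (U : Subset n) w xs → sumL w (filter (_∈? U) xs) ≡ sumL (restrict U w) xs
sumL-filter-∈ U w []       = refl
sumL-filter-∈ U w (x ∷ xs) with x ∈? U
... | yes _ = cong (w x +_) (sumL-filter-∈ U w xs)
... | no _  = trans (sumL-filter-∈ U w xs) (sym (+-identityˡ _))

update-≡ : ∀ (α : Fin n → ℚ) e a → update α e a e ≡ a
update-≡ α e a with e ≟ e
... | yes _   = refl
... | no e≢e  = ⊥-elim (e≢e refl)

update-≢ : ∀ (α : Fin n → ℚ) e a {x} → x ≢ e → update α e a x ≡ α x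
update-≢ α e a {x} x≢e with x ≟ e
... | yes x≡e = ⊥-elim (x≢e x≡e)
... | no _    = refl

module _ (N : Network n) where
  open Network N

  shortcut : ∀ w {e} i j → e ∈ path i → e ∈ path j → (∀ x → 0ℚ ≤ w x) →
             ∃[ k ] sumL w (path k) ≤ sumL w (before (path j) e) + w e + sumL w (from (path i) e)
  shortcut w {e} i j e∈Pᵢ e∈Pⱼ w≥0 with axiom j i e e∈Pⱼ e∈Pᵢ
  ... | k , Pₖ⊆axiom = k , subst (sumL w (path k) ≤_) sum≡ (sumL-mono-⊆ w≥0 (unique k) Pₖ⊆)
    where
    Q<e = before (path j) e
    P≥e = from (path i) e
    Pₖ⊆ : path k ⊆ (Q<e ++ [ e ]) ++ P≥e
    Pₖ⊆ x∈ with Pₖ⊆axiom _ x∈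
    ... | inj₁ x∈Q<e = ∈-++⁺ˡ x∈Q<e
    ... | inj₂ x∈P≥e = ∈-++⁺ʳ (Q<e ++ [ e ]) x∈P≥e
    sum≡ : sumL w ((Q<e ++ [ e ]) ++ P≥e) ≡ sumL w Q<e + w e + sumL w P≥e
    sum≡ = begin
      sumL w ((Q<e ++ [ e ]) ++ P≥e)        ≡⟨ sumL-++ w (Q<e ++ [ e ]) P≥e ⟩
      sumL w (Q<e ++ [ e ]) + sumL w P≥e    ≡⟨ cong (_+ sumL w P≥e) (sumL-++ w Q<e [ e ]) ⟩
      sumL w Q<e + (w e + 0ℚ) + sumL w P≥e  ≡⟨ cong (λ z → sumL w Q<e + z + sumL w P≥e) (+-identityʳ (w e)) ⟩
      sumL w Q<e + w e + sumL w P≥e         ∎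
      where open ≡-Reasoning

module Analysis (N : Network n) (ρ μ : Fin n → ℚ) (ρ≥0 : ∀ x → 0ℚ ≤ ρ x) (μ≥0 : ∀ x → 0ℚ ≤ μ x) where
  open Network N
  open Procedure N ρ μ

  μρ≥0 : ∀ x → 0ℚ ≤ μρ x
  μρ≥0 x = subst (_≤ μρ x) (+-identityˡ 0ℚ) (+-mono-≤ (μ≥0 x) (ρ≥0 x))

  load-restrict : ∀ U xs → load U xs ≡ sumL (restrict U μρ) xs
  load-restrict U = sumL-filter-∈ U μρ

  sumL-restrict-μρ : ∀ U xs → sumL (λ f → restrict U μ f + restrict U ρ f) xs ≡ sumL (restrict U μρ) xs
  sumL-restrict-μρ U = sumL-cong (λ x → sym (restrict-+ U μ ρ x))

  argmin-before-≤ : ∀ {U i e} → (∀ j → load U (path i) ≤ load U (path j)) →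
                    e ∈ path i → e ∉ₛ U → (∀ x → x ∈ before (path i) e → x ∈ₛ U) →
                    ∀ j → e ∈ path j → sumL μρ (before (path i) e) ≤ sumL (restrict U μρ) (before (path j) e)
  argmin-before-≤ {U} {i} {e} argmin e∈Pᵢ e∉U before⊆U j e∈Pⱼ
    with shortcut N (restrict U μρ) i j e∈Pᵢ e∈Pⱼ (restrict-nonneg U μρ≥0)
  ... | k , Pₖ≤ = +-cancelʳ-≤ F (begin
    sumL μρ P<e + F         ≡⟨ cong (_+ F) (sumL-restrict U μρ P<e before⊆U) ⟨
    sumL w̄ P<e + F          ≡⟨ sumL-++ w̄ P<e P≥e ⟨
    sumL w̄ (P<e ++ P≥e)     ≡⟨ cong (sumL w̄) (before-++-from (path i) e) ⟩
    sumL w̄ (path i)         ≡⟨ load-restrict U (path i) ⟨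
    load U (path i)         ≤⟨ argmin k ⟩
    load U (path k)         ≡⟨ load-restrict U (path k) ⟩
    sumL w̄ (path k)         ≤⟨ Pₖ≤ ⟩
    sumL w̄ Q<e + w̄ e + F    ≡⟨ cong (λ z → sumL w̄ Q<e + z + F) (restrict-∉ μρ e∉U) ⟩
    sumL w̄ Q<e + 0ℚ + F     ≡⟨ cong (_+ F) (+-identityʳ (sumL w̄ Q<e)) ⟩
    sumL w̄ Q<e + F          ∎)
    where
    open ≤-Reasoning
    w̄ = restrict U μρ
    P<e = before (path i) e
    Q<e = before (path j) e
    P≥e = from (path i) e
    F = sumL w̄ P≥e

  record Settled (U : Subset n) (e : Fin n) (a : ℚ) : Set where
    field
      via            : Fin m
      e∈via          : e ∈ path via
      before⊆U       : ∀ x → x ∈ before (path via) e → x ∈ₛ U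
      value≡         : a ≡ sumL μρ (before (path via) e) ⊓ (1ℚ - ρ e)
      before-minimal : ∀ j → e ∈ path j →
                       sumL μρ (before (path via) e) ≤ sumL (restrict U μρ) (before (path j) e)

  Invariant : State → Set
  Invariant (U , α) = ∀ e → e ∈ₛ U → Settled U e (α e)

  Settled-mono : ∀ {U V e a} → U ⊆ₛ V → Settled U e a → Settled V e a
  Settled-mono {e = e} U⊆V s = record
    { via            = via
    ; e∈via          = e∈via
    ; before⊆U       = λ x x∈ → U⊆V (before⊆U x x∈)
    ; value≡         = value≡
    ; before-minimal = λ j e∈Pⱼ →
        ≤-trans (before-minimal j e∈Pⱼ) (sumL-mono (restrict-mono μρ≥0 U⊆V) (before (path j) e))
    }
    where open Settled s

  Invariant-initial : Invariant initial
  Invariant-initial e e∈∅ = ⊥-elim (∉⊥ e∈∅)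

  Invariant-step : ∀ {s t} → Step s t → Invariant s → Invariant t
  Invariant-step {U , α} (step i e _ argmin e∈Pᵢ e∉U before⊆U) inv x x∈U∪e
    with x∈p∪q⁻ U ⁅ e ⁆ x∈U∪e
  ... | inj₁ x∈U =
    subst (Settled _ x) (sym (update-≢ α e _ (λ { refl → e∉U x∈U })))
          (Settled-mono (p⊆p∪q ⁅ e ⁆) (inv x x∈U))
  ... | inj₂ x∈⁅e⁆ with x∈⁅y⁆⇒x≡y e x∈⁅e⁆
  ...   | refl = subst (Settled _ e) (sym (update-≡ α e _)) (Settled-mono (p⊆p∪q ⁅ e ⁆) (record
    { via            = i
    ; e∈via          = e∈Pᵢ
    ; before⊆U       = before⊆U
    ; value≡         = refl
    ; before-minimal = argmin-before-≤ argmin e∈Pᵢ e∉U before⊆U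
    }))

  Invariant-run : ∀ {s t} → Star Step s t → Invariant s → Invariant t
  Invariant-run ε           inv = inv
  Invariant-run (st ◅ run)  inv = Invariant-run run (Invariant-step st inv)

  terminal-covers : ∀ {U α} → Terminal (U , α) →
                    ∀ j → 1ℚ - sumL (restrict U μ) (path j) ≤ sumL (restrict U ρ) (path j)
  terminal-covers {U} terminal j =
    p≤q+r⇒p-q≤r {q = sumL (restrict U μ) (path j)} (subst (1ℚ ≤_) load≡ (terminal j))
    where
    open ≡-Reasoning
    load≡ : load U (path j) ≡ sumL (restrict U μ) (path j) + sumL (restrict U ρ) (path j)
    load≡ = begin
      load U (path j)                                          ≡⟨ load-restrict U (path j) ⟩
      sumL (restrict U μρ) (path j)                            ≡⟨ sumL-restrict-μρ U (path j) ⟨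
      sumL (λ f → restrict U μ f + restrict U ρ f) (path j)    ≡⟨ sumL-+ (restrict U μ) (restrict U ρ) (path j) ⟩
      sumL (restrict U μ) (path j) + sumL (restrict U ρ) (path j) ∎

  Candidate : Subset n → Fin n → ℚ → Set
  Candidate U e b =
    (∃[ j ] (e ∈ path j × b ≡ sumL (λ f → restrict U μ f + restrict U ρ f) (before (path j) e)))
    ⊎ b ≡ 1ℚ - restrict U ρ e

  Settled-isMinOf : ∀ {U e a} → e ∈ₛ U → Settled U e a → IsMinOf a (Candidate U e)
  Settled-isMinOf {U} {e} e∈U s =
    subst (λ a → IsMinOf a (Candidate U e)) (sym value≡) (⊓-isMinOf via-candidate ρ-candidate lower)
    where
    open Settled s
    P<e = before (path via) e
    via-candidate : Candidate U e (sumL μρ P<e)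
    via-candidate = inj₁ (via , e∈via , sym (trans (sumL-restrict-μρ U P<e) (sumL-restrict U μρ P<e before⊆U)))
    ρ-candidate : Candidate U e (1ℚ - ρ e)
    ρ-candidate = inj₂ (cong (λ r → 1ℚ - r) (sym (restrict-∈ ρ e∈U)))
    lower : ∀ c → Candidate U e c → sumL μρ P<e ≤ c ⊎ 1ℚ - ρ e ≤ c
    lower c (inj₁ (j , e∈Pⱼ , c≡)) =
      inj₁ (subst (sumL μρ P<e ≤_) (sym (trans c≡ (sumL-restrict-μρ U (before (path j) e)))) (before-minimal j e∈Pⱼ))
    lower c (inj₂ c≡) = inj₂ (≤-reflexive (sym (trans c≡ (cong (λ r → 1ℚ - r) (restrict-∈ ρ e∈U)))))

lemma3 : {n : ℕ} (N : Network n) (ρ μ : Fin n → ℚ) →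
    (∀ e → 0ℚ ≤ ρ e × ρ e ≤ 1ℚ) → (∀ e → 0ℚ ≤ μ e × μ e ≤ 1ℚ) →
    (∀ j → 1ℚ - sumL μ (Network.path N j) ≤ sumL ρ (Network.path N j)) →
    (U : Subset n) (α : Fin n → ℚ) → Procedure.Output N ρ μ U α →
    (∀ j → 1ℚ - sumL (restrict U μ) (Network.path N j)
             ≤ sumL (restrict U ρ) (Network.path N j))
    × (∀ e → e ∈ₛ U →
         IsMinOf (α e) (λ b →
           (∃[ j ] (e ∈ Network.path N j
                    × b ≡ sumL (λ f → restrict U μ f + restrict U ρ f)
                               (before (Network.path N j) e)))
           ⊎ b ≡ 1ℚ - restrict U ρ e))
-- The covering hypothesis only serves to make the procedure terminate, and Output already
-- provides a terminated run; of the bounds on ρ and μ only nonnegativity is needed.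
lemma3 N ρ μ ρ-bounds μ-bounds _ U α (run , terminal) =
  terminal-covers {α = α} terminal ,
  λ e e∈U → Settled-isMinOf e∈U (Invariant-run run Invariant-initial e e∈U)
  where open Analysis N ρ μ (proj₁ ∘ ρ-bounds) (proj₁ ∘ μ-bounds)
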